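{- If $G$ is a complete expansion of the complement of a bipartite graph, then $G$ is $k$-indicated colorable for every $k\geq\chi(G)$.
   Context: All graphs are finite, simple and undirected. Indicated coloring game with $k$ colors: each round Ann selects an uncolored vertex and Ben colors it properly with one of the $k$ colors; Ann wins if all vertices get colored, Ben wins if some uncolored vertex has all $k$ colors on its neighbors. A graph is $k$-indicated colorable if Ann has a winning strategy with $k$ colors. For a graph $F$ on vertices $v_1,\dots,v_n$ and positive integers $m_1,\dots,m_n$, the complete expansion $\mathbb{K}[F](m_1,\dots,m_n)$ is obtained by replacing each $v_i$ by a complete graph $K_{m_i}$ and joining every vertex of the $i$-th and $j$-th copies whenever $v_iv_j\in E(F)$. -}

module Defs where

open import Data.Nat using (ℕ; _≤_)
open import Data.Fin using (Fin)
open import Data.Fin.Properties using (_≟_)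
open import Data.Bool using (Bool; true; false; not; _∧_)
open import Data.Maybe using (Maybe; just; nothing)
open import Data.Product using (Σ; ∃; _×_; _,_)
open import Data.Empty using (⊥)
open import Relation.Nullary using (¬_; Dec; yes; no; does)
open import Relation.Binary.PropositionalEquality using (_≡_; _≢_; refl)
open import Function.Bundles using (_↔_; Inverse)

record Graph (n : ℕ) : Set where
  field
    adj    : Fin n → Fin n → Bool
    sym    : ∀ u v → adj u v ≡ adj v u
    irrefl : ∀ v → adj v v ≡ false
open Graph public

ProperColoring : ∀ {n} → Graph n → (k : ℕ) → (Fin n → Fin k) → Set
ProperColoring G k c = ∀ u v → adj G u v ≡ true → c u ≢ c v

Colorable : ∀ {n} → Graph n → ℕ → Set
Colorable G k = Σ (_ → Fin k) (ProperColoring G k)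

IsChromaticNumber : ∀ {n} → Graph n → ℕ → Set
IsChromaticNumber G χ = Colorable G χ × (∀ k → Colorable G k → χ ≤ k)

-- a game position: partial colouring (nothing = uncoloured)
Position : ℕ → ℕ → Set
Position n k = Fin n → Maybe (Fin k)

update : ∀ {n k} → Position n k → Fin n → Fin k → Position n k
update c v a w with does (w ≟ v)
... | true  = just a
... | false = c w

Admissible : ∀ {n k} → Graph n → Position n k → Fin n → Fin k → Set
Admissible G c v a = ∀ w → adj G v w ≡ true → c w ≢ just a

Blocked : ∀ {n k} → Graph n → Position n k → Fin n → Set
Blocked G c v = ∀ a → ∃ λ w → adj G v w ≡ true × c w ≡ just a

-- Ann has a winning strategy from position c (the game is finite, so an
-- inductive predicate captures existence of a winning strategy)
data AnnWins {n k : ℕ} (G : Graph n) : Position n k → Set where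
  done : ∀ {c} → (∀ v → c v ≢ nothing) → AnnWins G c
  move : ∀ {c} → (∀ u → c u ≡ nothing → ¬ Blocked G c u)
       → (v : Fin n) → c v ≡ nothing
       → (∀ a → Admissible G c v a → AnnWins G (update c v a))
       → AnnWins G c

IndicatedColorable : ∀ {n} → Graph n → ℕ → Set
IndicatedColorable {n} G k = AnnWins {n} {k} G (λ _ → nothing)

complementAdj : ∀ {p} → Graph p → Fin p → Fin p → Bool
complementAdj F u v = not (adj F u v) ∧ not (does (u ≟ v))

Bipartite : ∀ {p} → Graph p → Set
Bipartite {p} F = Σ (Fin p → Bool) λ side → ∀ u v → adj F u v ≡ true → side u ≢ side v

-- vertex set of K[F](m₁,…,m_p): pairs (i , a) with a ∈ Fin (m i)
ExpVertex : ∀ {p} → (Fin p → ℕ) → Set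
ExpVertex {p} m = Σ (Fin p) λ i → Fin (m i)

expAdjAux : ∀ {p} (R : Fin p → Fin p → Bool) (m : Fin p → ℕ)
  (i j : Fin p) → Fin (m i) → Fin (m j) → Dec (i ≡ j) → Bool
expAdjAux R m i .i a b (yes refl) = not (does (a ≟ b))
expAdjAux R m i j a b (no _) = R i j

expAdj : ∀ {p} (R : Fin p → Fin p → Bool) (m : Fin p → ℕ) →
         ExpVertex m → ExpVertex m → Bool
expAdj R m (i , a) (j , b) = expAdjAux R m i j a b (i ≟ j)

IsomorphicTo : ∀ {n} {V : Set} → Graph n → (V → V → Bool) → Set
IsomorphicTo {n} {V} G H =
  Σ (Fin n ↔ V) λ φ → ∀ u v → adj G u v ≡ H (Inverse.to φ u) (Inverse.to φ v)

module Submission where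

-- If F is bipartite with sides A and B, then in K[F̄](m) two vertices whose
-- F-vertices lie on the same side are adjacent, so G ≅ K[F̄](m) is covered by
-- two cliques.  For such a graph Ann wins with any k ≥ χ(G) colours by keeping
-- the invariant that the current partial colouring extends to a proper
-- k-colouring of G.  She first colours the first clique: each chosen vertex is
-- adjacent to everything coloured so far, so any admissible colour keeps the
-- position extendable (swap the two colours involved in a completion).  Then
-- the uncoloured vertices form a clique, and a cycle argument shows that some
-- uncoloured vertex is still safe: if every uncoloured b had a bad admissible
-- colour, that colour would be the completion colour of another uncoloured
-- vertex, and rotating completion colours along a cycle of this "blocking"
-- map would produce a completion contradicting badness.

open import Defs hiding (sym)
open import Data.Nat using (ℕ; zero; suc; _≤_; _<_; _+_; _*_)
open import Data.Nat.Properties using (n<1+n; *-comm; +-suc; ≤-pred; ≤-<-trans; m≤n+m; m≤n⇒∃[o]m+o≡n)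
open import Data.Nat.Induction using (<-wellFounded)
open import Data.Nat.GeneralisedArithmetic using (iterate)
open import Induction.WellFounded using (Acc; acc)
open import Data.Fin using (Fin; zero; suc; toℕ; fromℕ<; inject≤)
open import Data.Fin.Properties using (_≟_; any?; all?; ¬∀⟶∃¬; pigeonhole; inject≤-injective; toℕ-fromℕ<; toℕ<n)
open import Data.Fin.Subset using (Subset; ∣_∣; _∈_; _∉_)
open import Data.Fin.Subset.Properties using (p⊂q⇒∣p∣<∣q∣)
open import Data.Fin.Permutation.Components using (transpose; transpose-inverse)
open import Data.Vec using (tabulate)
open import Data.Vec.Properties using (lookup∘tabulate; []=⇒lookup; lookup⇒[]=)
open import Data.Vec.Functional using (_∷_; head; tail)
open import Data.Bool using (Bool; true; false)
open import Data.Bool.Properties using (¬-not) renaming (_≟_ to _≟ᵇ_)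
open import Data.Maybe using (Maybe; just; nothing; is-nothing)
open import Data.Maybe.Properties using (≡-dec; just-injective)
open import Data.Product using (Σ; ∃; _×_; _,_; proj₁; proj₂)
open import Data.Sum using (_⊎_; inj₁; inj₂)
open import Data.Empty using (⊥; ⊥-elim)
open import Relation.Nullary using (¬_; Dec; yes; no)
open import Relation.Nullary.Decidable using (_×-dec_; _→-dec_; ¬?; dec-true; dec-false; decidable-stable)
open import Relation.Binary.PropositionalEquality using (_≡_; _≢_; refl; sym; trans; cong; subst; module ≡-Reasoning)
open import Function.Bundles using (Inverse; Injection)
open import Function.Properties.Inverse using (↔⇒↣)

Extensional : ∀ {n k} → ((Fin n → Fin k) → Set) → Set
Extensional P = ∀ f g → (∀ i → f i ≡ g i) → P f → P g

-- There are finitely many functions Fin n → Fin k, so the existence of one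
-- with a decidable extensional property is decidable: choose the value at
-- zero and search the tail recursively.
∃-function? : ∀ n {k} (P : (Fin n → Fin k) → Set) → (∀ f → Dec (P f)) →
              Extensional P → Dec (Σ (Fin n → Fin k) P)
∃-function? zero P P? resp with P? (λ ())
... | yes p = yes (_ , p)
... | no ¬p = no λ { (f , pf) → ¬p (resp f _ (λ ()) pf) }
∃-function? (suc n) P P? resp
  with any? (λ x → ∃-function? n (λ g → P (x ∷ g)) (λ g → P? (x ∷ g))
                     (λ g h g≐h → resp (x ∷ g) (x ∷ h) λ { zero → refl ; (suc i) → g≐h i }))
... | yes (x , g , p) = yes (x ∷ g , p)
... | no ¬p = no λ { (f , pf) →
        ¬p (head f , tail f , resp f _ (λ { zero → refl ; (suc i) → refl }) pf) }

transpose-here : ∀ {k} (i j : Fin k) → transpose i j i ≡ j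
transpose-here i j rewrite dec-true (i ≟ i) refl = refl

transpose-elsewhere : ∀ {k} {i j x : Fin k} → x ≢ i → x ≢ j → transpose i j x ≡ x
transpose-elsewhere {i = i} {j} {x} x≢i x≢j
  rewrite dec-false (x ≟ i) x≢i | dec-false (x ≟ j) x≢j = refl

transpose-injective : ∀ {k} (i j : Fin k) {x y} → transpose i j x ≡ transpose i j y → x ≡ y
transpose-injective i j {x} {y} eq = begin
  x                                 ≡⟨ sym (transpose-inverse j i) ⟩
  transpose j i (transpose i j x)   ≡⟨ cong (transpose j i) eq ⟩
  transpose j i (transpose i j y)   ≡⟨ transpose-inverse j i ⟩
  y                                 ∎
  where open ≡-Reasoning

-- Orbits of an endofunction N of a finite set.  Every orbit runs into a
-- periodic point, and N is injective on periodic points; this is what makes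
-- "rotating along a cycle" of N well defined.
module Orbits {n : ℕ} (N : Fin n → Fin n) where
  open ≡-Reasoning

  iterate-step : ∀ t x → iterate N (N x) t ≡ N (iterate N x t)
  iterate-step zero    x = refl
  iterate-step (suc t) x = iterate-step t (N x)

  iterate-+ : ∀ s t x → iterate N x (s + t) ≡ iterate N (iterate N x s) t
  iterate-+ zero    t x = refl
  iterate-+ (suc s) t x = iterate-+ s t (N x)

  period-multiple : ∀ q p x → iterate N x (suc p) ≡ x → iterate N x (q * suc p) ≡ x
  period-multiple zero    p x h = refl
  period-multiple (suc q) p x h = begin
    iterate N x (suc p + q * suc p)               ≡⟨ iterate-+ (suc p) (q * suc p) x ⟩
    iterate N (iterate N x (suc p)) (q * suc p)   ≡⟨ cong (λ y → iterate N y (q * suc p)) h ⟩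
    iterate N x (q * suc p)                       ≡⟨ period-multiple q p x h ⟩
    x                                             ∎

  -- x returns to itself after 1 ≤ suc p ≤ n steps (the bound makes it decidable).
  Periodic : Fin n → Set
  Periodic x = ∃ λ (p : Fin n) → iterate N x (suc (toℕ p)) ≡ x

  periodic? : ∀ x → Dec (Periodic x)
  periodic? x = any? λ p → iterate N x (suc (toℕ p)) ≟ x

  periodic-step : ∀ {x} → Periodic x → Periodic (N x)
  periodic-step {x} (p , h) = p , trans (iterate-step (suc (toℕ p)) x) (cong N h)

  -- Periodic points are recovered from their images by iterating a common
  -- multiple of both periods.
  periodic-injective : ∀ {x y} → Periodic x → Periodic y → N x ≡ N y → x ≡ y
  periodic-injective {x} {y} (p′ , x-per) (q′ , y-per) Nx≡Ny = begin
    x                                  ≡⟨ sym (period-multiple (suc q) p x x-per) ⟩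
    iterate N (N x) (p + q * suc p)   ≡⟨ cong (λ z → iterate N z (p + q * suc p)) Nx≡Ny ⟩
    iterate N y (suc q * suc p)       ≡⟨ cong (iterate N y) (*-comm (suc q) (suc p)) ⟩
    iterate N y (suc p * suc q)       ≡⟨ period-multiple (suc p) q y y-per ⟩
    y                                  ∎
    where
      p q : ℕ
      p = toℕ p′
      q = toℕ q′

  -- By pigeonhole two of x, N x, …, Nⁿ x coincide, say Nⁱ x = Nʲ x with
  -- i < j; then Nⁱ x has period j - i ≤ n.
  orbit-periodic : ∀ x → ∃ λ t → Periodic (iterate N x t)
  orbit-periodic x with pigeonhole (n<1+n n) (λ t → iterate N x (toℕ t))
  ... | i , j , i<j , Nⁱx≡Nʲx with m≤n⇒∃[o]m+o≡n i<j
  ...   | o , i+1+o≡j = toℕ i , fromℕ< o<n , returns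
    where
      o<n : o < n
      o<n = ≤-<-trans (m≤n+m o (toℕ i)) (subst (_≤ n) (sym i+1+o≡j) (≤-pred (toℕ<n j)))
      returns : iterate N (iterate N x (toℕ i)) (suc (toℕ (fromℕ< o<n))) ≡ iterate N x (toℕ i)
      returns rewrite toℕ-fromℕ< o<n = begin
        iterate N (iterate N x (toℕ i)) (suc o)   ≡⟨ sym (iterate-+ (toℕ i) (suc o) x) ⟩
        iterate N x (toℕ i + suc o)               ≡⟨ cong (iterate N x) (trans (+-suc (toℕ i) o) i+1+o≡j) ⟩
        iterate N x (toℕ j)                       ≡⟨ sym Nⁱx≡Nʲx ⟩
        iterate N x (toℕ i)                       ∎

just⇒≢nothing : ∀ {A : Set} {m : Maybe A} {a} → m ≡ just a → m ≢ nothing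
just⇒≢nothing refl ()

is-nothing⇒≡nothing : ∀ {A : Set} (m : Maybe A) → is-nothing m ≡ true → m ≡ nothing
is-nothing⇒≡nothing nothing _ = refl

adjacent⇒distinct : ∀ {n} (G : Graph n) {u w} → adj G u w ≡ true → u ≢ w
adjacent⇒distinct G {u} uw refl with () ← trans (sym (irrefl G u)) uw

CoveredByTwoCliques : ∀ {n} → Graph n → (Fin n → Bool) → Set
CoveredByTwoCliques G side = ∀ u w → side u ≡ side w → u ≢ w → adj G u w ≡ true

module IndicatedGame {n k : ℕ} (G : Graph n) where

  update-here : ∀ (c : Position n k) v a → update c v a v ≡ just a
  update-here c v a rewrite dec-true (v ≟ v) refl = refl

  update-elsewhere : ∀ (c : Position n k) {v} a {w} → w ≢ v → update c v a w ≡ c w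
  update-elsewhere c {v} a {w} w≢v rewrite dec-false (w ≟ v) w≢v = refl

  -- The uncoloured vertices; every move shrinks this set, so the game ends.
  uncoloured : Position n k → Subset n
  uncoloured c = tabulate (λ w → is-nothing (c w))

  ∈-uncoloured⁺ : ∀ {c w} → c w ≡ nothing → w ∈ uncoloured c
  ∈-uncoloured⁺ {c} {w} cw =
    lookup⇒[]= w (uncoloured c) (trans (lookup∘tabulate _ w) (cong is-nothing cw))

  ∈-uncoloured⁻ : ∀ {c w} → w ∈ uncoloured c → c w ≡ nothing
  ∈-uncoloured⁻ {c} {w} w∈ =
    is-nothing⇒≡nothing (c w) (trans (sym (lookup∘tabulate _ w)) ([]=⇒lookup w∈))

  update-shrinks : ∀ c v a → c v ≡ nothing → ∣ uncoloured (update c v a) ∣ < ∣ uncoloured c ∣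
  update-shrinks c v a cv = p⊂q⇒∣p∣<∣q∣ (still-uncoloured , v , ∈-uncoloured⁺ cv , v-coloured)
    where
      v-coloured : v ∉ uncoloured (update c v a)
      v-coloured v∈ with () ← trans (sym (update-here c v a)) (∈-uncoloured⁻ v∈)
      still-uncoloured : ∀ {w} → w ∈ uncoloured (update c v a) → w ∈ uncoloured c
      still-uncoloured {w} w∈ with w ≟ v
      ... | yes refl = ⊥-elim (v-coloured w∈)
      ... | no w≢v = ∈-uncoloured⁺ (trans (sym (update-elsewhere c a w≢v)) (∈-uncoloured⁻ w∈))

  Extends : Position n k → (Fin n → Fin k) → Set
  Extends c f = ∀ w a → c w ≡ just a → f w ≡ a

  Extendable : Position n k → Set
  Extendable c = Σ (Fin n → Fin k) λ f → ProperColoring G k f × Extends c f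

  extendable? : ∀ c → Dec (Extendable c)
  extendable? c = ∃-function? n _ (λ f → proper? f ×-dec extends? f) resp
    where
      proper? : ∀ f → Dec (ProperColoring G k f)
      proper? f = all? λ u → all? λ v → (adj G u v ≟ᵇ true) →-dec ¬? (f u ≟ f v)
      extends? : ∀ f → Dec (Extends c f)
      extends? f = all? λ w → all? λ a → ≡-dec _≟_ (c w) (just a) →-dec (f w ≟ a)
      resp : Extensional (λ f → ProperColoring G k f × Extends c f)
      resp f g f≐g (f-proper , f-ext) =
        (λ u v uv gu≡gv → f-proper u v uv (trans (f≐g u) (trans gu≡gv (sym (f≐g v))))) ,
        (λ w a cw → trans (sym (f≐g w)) (f-ext w a cw))

  extendable⇒unblocked : ∀ {c} → Extendable c → ∀ u → c u ≡ nothing → ¬ Blocked G c u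
  extendable⇒unblocked (f , f-proper , f-ext) u _ blocked with blocked (f u)
  ... | w , uw , cw = f-proper u w uw (sym (f-ext w (f u) cw))

  extends-update : ∀ {c f} v a → Extends c f → f v ≡ a → Extends (update c v a) f
  extends-update v a f-ext fv w a′ cw with w ≟ v
  ... | yes refl = trans fv (just-injective cw)
  ... | no _ = f-ext w a′ cw

  Safe : Position n k → Fin n → Set
  Safe c v = ∀ a → Admissible G c v a → Extendable (update c v a)

  admissible? : ∀ (c : Position n k) v a → Dec (Admissible G c v a)
  admissible? c v a = all? λ w → (adj G v w ≟ᵇ true) →-dec ¬? (≡-dec _≟_ (c w) (just a))

  safe? : ∀ c v → Dec (Safe c v)
  safe? c v = all? λ a → admissible? c v a →-dec extendable? (update c v a)

  -- In a completion f, neither f v nor an admissible a occurs on a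
  -- coloured vertex, so exchanging them gives a completion with v ↦ a.
  dominating-safe : ∀ {c v} → c v ≡ nothing → (∀ w → c w ≢ nothing → adj G v w ≡ true) →
                    Extendable c → Safe c v
  dominating-safe {c} {v} cv dominates (f , f-proper , f-ext) a admissible =
    swapped , swapped-proper , extends-update v a swapped-ext (transpose-here (f v) a)
    where
      swapped : Fin n → Fin k
      swapped w = transpose (f v) a (f w)
      swapped-proper : ProperColoring G k swapped
      swapped-proper u w uw eq = f-proper u w uw (transpose-injective (f v) a eq)
      swapped-ext : Extends c swapped
      swapped-ext w a′ cw = trans (transpose-elsewhere ≢fv ≢a) (f-ext w a′ cw)
        where
          vw : adj G v w ≡ true
          vw = dominates w (just⇒≢nothing cw)
          ≢fv : f w ≢ f v
          ≢fv eq = f-proper v w vw (sym eq)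
          ≢a : f w ≢ a
          ≢a eq = admissible w vw (trans cw (cong just (trans (sym (f-ext w a′ cw)) eq)))

  UncolouredClique : Position n k → Set
  UncolouredClique c = ∀ u w → c u ≡ nothing → c w ≡ nothing → u ≢ w → adj G u w ≡ true

  -- If colouring the uncoloured b with the admissible a destroys
  -- extendability, then a = f y for some uncoloured y: otherwise no neighbour
  -- has f-colour a, and recolouring b with a in the completion f would be a
  -- completion of the new position.
  blocker : ∀ {c f b a} → ProperColoring G k f → Extends c f → c b ≡ nothing →
            Admissible G c b a → ¬ Extendable (update c b a) → ∃ λ y → c y ≡ nothing × f y ≡ a
  blocker {c} {f} {b} {a} f-proper f-ext cb admissible stuck
    with any? (λ y → (adj G b y ≟ᵇ true) ×-dec (f y ≟ a))
  ... | yes (y , by , fy) = y , y-uncoloured (c y) refl , fy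
    where
      y-uncoloured : ∀ m → c y ≡ m → c y ≡ nothing
      y-uncoloured nothing  cy = cy
      y-uncoloured (just z) cy =
        ⊥-elim (admissible y by (trans cy (cong just (trans (sym (f-ext y z cy)) fy))))
  ... | no a-free = ⊥-elim (stuck (recoloured , recoloured-proper ,
                                   extends-update b a recoloured-ext recoloured-here))
    where
      recoloured : Fin n → Fin k
      recoloured w with w ≟ b
      ... | yes _ = a
      ... | no _  = f w
      recoloured-here : recoloured b ≡ a
      recoloured-here with b ≟ b
      ... | yes _ = refl
      ... | no b≢b = ⊥-elim (b≢b refl)
      recoloured-proper : ProperColoring G k recoloured
      recoloured-proper u w uw with u ≟ b | w ≟ b
      ... | yes refl | yes refl = ⊥-elim (adjacent⇒distinct G uw refl)
      ... | yes refl | no _     = λ eq → a-free (w , uw , sym eq)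
      ... | no _     | yes refl = λ eq → a-free (u , trans (Graph.sym G w u) uw , eq)
      ... | no _     | no _     = f-proper u w uw
      recoloured-ext : Extends c recoloured
      recoloured-ext w a′ cw with w ≟ b
      ... | yes refl = ⊥-elim (just⇒≢nothing cw cb)
      ... | no _     = f-ext w a′ cw

  -- The hypotheses of the clique lemma together with the assumption that no
  -- uncoloured vertex is safe; these are contradictory (see absurd).
  module NoSafeVertex {c} (clique : UncolouredClique c)
                      {f} (f-proper : ProperColoring G k f) (f-ext : Extends c f)
                      (unsafe : ∀ b → c b ≡ nothing → ¬ Safe c b) where

    Blocks : Fin n → Fin n → Set
    Blocks y b = c y ≡ nothing × Admissible G c b (f y) × ¬ Extendable (update c b (f y))

    blocked-by : ∀ b → c b ≡ nothing → ∃ λ y → Blocks y b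
    blocked-by b cb
      with ¬∀⟶∃¬ k (λ a → Admissible G c b a → Extendable (update c b a))
                  (λ a → admissible? c b a →-dec extendable? (update c b a)) (unsafe b cb)
    ... | a , ¬safe-a = blocks (blocker f-proper f-ext cb admissible stuck)
      where
        admissible : Admissible G c b a
        admissible = decidable-stable (admissible? c b a) λ ¬adm → ¬safe-a λ adm → ⊥-elim (¬adm adm)
        stuck : ¬ Extendable (update c b a)
        stuck ext = ¬safe-a λ _ → ext
        blocks : (∃ λ y → c y ≡ nothing × f y ≡ a) → ∃ λ y → Blocks y b
        blocks (y , cy , fy≡a) = y , cy , subst (Admissible G c b) (sym fy≡a) admissible ,
                                 subst (λ a′ → ¬ Extendable (update c b a′)) (sym fy≡a) stuck

    next-from : ∀ b (m : Maybe (Fin k)) → c b ≡ m → Fin n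
    next-from b nothing  cb = proj₁ (blocked-by b cb)
    next-from b (just _) _  = b

    next : Fin n → Fin n
    next b = next-from b (c b) refl

    next-blocks : ∀ b → c b ≡ nothing → Blocks (next b) b
    next-blocks b = blocks-from (c b) refl
      where
        blocks-from : ∀ m (cb : c b ≡ m) → m ≡ nothing → Blocks (next-from b m cb) b
        blocks-from nothing  cb _ = proj₂ (blocked-by b cb)
        blocks-from (just _) _  ()

    next-uncoloured : ∀ {b} → c b ≡ nothing → c (next b) ≡ nothing
    next-uncoloured {b} cb = proj₁ (next-blocks b cb)

    open Orbits next

    OnCycle : Fin n → Set
    OnCycle x = c x ≡ nothing × Periodic x

    onCycle? : ∀ x → Dec (OnCycle x)
    onCycle? x = ≡-dec _≟_ (c x) nothing ×-dec periodic? x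

    onCycle-next : ∀ {x} → OnCycle x → OnCycle (next x)
    onCycle-next (cx , x-per) = next-uncoloured cx , periodic-step x-per

    reaches-cycle : ∀ t {x} → c x ≡ nothing → c (iterate next x t) ≡ nothing
    reaches-cycle zero    cx = cx
    reaches-cycle (suc t) cx = reaches-cycle t (next-uncoloured cx)

    rotated : Fin n → Fin k
    rotated w with onCycle? w
    ... | yes _ = f (next w)
    ... | no _  = f w

    rotated-on : ∀ {w} → OnCycle w → rotated w ≡ f (next w)
    rotated-on {w} on with onCycle? w
    ... | yes _ = refl
    ... | no off = ⊥-elim (off on)

    rotated-off : ∀ {w} → ¬ OnCycle w → rotated w ≡ f w
    rotated-off {w} off with onCycle? w
    ... | yes on = ⊥-elim (off on)
    ... | no _  = refl

    -- A neighbour w of a cycle vertex u that is off the cycle does not have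
    -- colour f (next u): if coloured, because f (next u) is admissible for u;
    -- if uncoloured, because w ≠ next u lies in the clique with next u.
    off-cycle : ∀ u w → adj G u w ≡ true → OnCycle u → ¬ OnCycle w → f (next u) ≢ f w
    off-cycle u w uw (cu , u-per) w-off eq = by-colour (c w) refl
      where
        by-colour : ∀ m → c w ≡ m → ⊥
        by-colour (just z) cw = proj₁ (proj₂ (next-blocks u cu)) w uw
                                  (trans cw (cong just (trans (sym (f-ext w z cw)) (sym eq))))
        by-colour nothing cw with w ≟ next u
        ... | yes w≡nu = w-off (subst OnCycle (sym w≡nu) (onCycle-next (cu , u-per)))
        ... | no w≢nu  = f-proper w (next u) (clique w (next u) cw (next-uncoloured cu) w≢nu) (sym eq)

    -- On cycles the rotation is injective because next is.
    rotated-proper : ProperColoring G k rotated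
    rotated-proper u w uw with onCycle? u | onCycle? w
    ... | yes (cu , u-per) | yes (cw , w-per) =
          f-proper (next u) (next w)
            (clique _ _ (next-uncoloured cu) (next-uncoloured cw)
              (λ nu≡nw → adjacent⇒distinct G uw (periodic-injective u-per w-per nu≡nw)))
    ... | yes on | no off = off-cycle u w uw on off
    ... | no off | yes on = λ eq → off-cycle w u (trans (Graph.sym G w u) uw) on off (sym eq)
    ... | no _   | no _   = f-proper u w uw

    rotated-ext : ∀ {x} → OnCycle x → Extends (update c x (f (next x))) rotated
    rotated-ext {x} on = extends-update x _ agrees (rotated-on on)
      where
        agrees : Extends c rotated
        agrees w a cw = trans (rotated-off (λ on′ → just⇒≢nothing cw (proj₁ on′))) (f-ext w a cw)

    -- A cycle vertex x exists, and the rotation completes the position in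
    -- which x has its bad colour f (next x).
    absurd : ∀ {v} → c v ≡ nothing → ⊥
    absurd {v} cv with orbit-periodic v
    ... | t , per = proj₂ (proj₂ (next-blocks x (proj₁ on)))
                      (rotated , rotated-proper , rotated-ext on)
      where
        x : Fin n
        x = iterate next v t
        on : OnCycle x
        on = reaches-cycle t cv , per

  clique-safe : ∀ {c} → UncolouredClique c → Extendable c →
                ∀ {v} → c v ≡ nothing → ∃ λ b → c b ≡ nothing × Safe c b
  clique-safe {c} clique (f , f-proper , f-ext) cv
    with any? (λ b → ≡-dec _≟_ (c b) nothing ×-dec safe? c b)
  ... | yes found = found
  ... | no none = ⊥-elim (NoSafeVertex.absurd clique f-proper f-ext
                           (λ b cb safe → none (b , cb , safe)) cv)

  -- Ann's strategy on a graph covered by the two cliques side ≡ true and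
  -- side ≡ false: first colour the first clique, then the second.
  module TwoCliqueStrategy (side : Fin n → Bool) (cover : CoveredByTwoCliques G side) where

    FirstPhase SecondPhase Phase : Position n k → Set
    FirstPhase c = ∀ w → c w ≢ nothing → side w ≡ true
    SecondPhase c = ∀ w → side w ≡ true → c w ≢ nothing
    Phase c = FirstPhase c ⊎ SecondPhase c

    first-phase-update : ∀ {c v a} → FirstPhase c → side v ≡ true → FirstPhase (update c v a)
    first-phase-update {v = v} first sv w uw with w ≟ v
    ... | yes refl = sv
    ... | no _ = first w uw

    second-phase-update : ∀ {c v a} → SecondPhase c → SecondPhase (update c v a)
    second-phase-update {v = v} second w sw uw with w ≟ v
    ... | yes refl with () ← uw
    ... | no _ = second w sw uw

    first-dominates : ∀ {c v} → FirstPhase c → side v ≡ true → c v ≡ nothing →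
                      ∀ w → c w ≢ nothing → adj G v w ≡ true
    first-dominates first sv cv w cw =
      cover _ w (trans sv (sym (first w cw))) (λ { refl → cw cv })

    second-clique : ∀ {c} → SecondPhase c → UncolouredClique c
    second-clique {c} second u w cu cw = cover u w (trans (in-second cu) (sym (in-second cw)))
      where
        in-second : ∀ {x} → c x ≡ nothing → side x ≡ false
        in-second {x} cx = ¬-not (λ sx → second x sx cx)

    ann-move : ∀ c → Extendable c → Phase c → ∀ {v₀} → c v₀ ≡ nothing →
               ∃ λ v → c v ≡ nothing × Safe c v × (∀ a → Phase (update c v a))
    ann-move c E phase cv₀ with any? (λ w → ≡-dec _≟_ (c w) nothing ×-dec (side w ≟ᵇ true))
    ann-move c E (inj₁ first) cv₀ | yes (v , cv , sv) =
      v , cv , dominating-safe cv (first-dominates first sv cv) E ,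
      λ _ → inj₁ (first-phase-update first sv)
    ann-move c E (inj₂ second) cv₀ | yes (v , cv , sv) = ⊥-elim (second v sv cv)
    ann-move c E _ cv₀ | no none =
      let b , cb , safe = clique-safe (second-clique second) E cv₀
      in  b , cb , safe , λ _ → inj₂ (second-phase-update second)
      where
        second : SecondPhase c
        second w sw cw = none (w , cw , sw)

    win : ∀ c → Acc _<_ ∣ uncoloured c ∣ → Extendable c → Phase c → AnnWins G c
    win c (acc smaller) E phase with any? (λ w → ≡-dec _≟_ (c w) nothing)
    ... | no all-coloured = done λ v cv → all-coloured (v , cv)
    ... | yes (_ , cv₀) with ann-move c E phase cv₀
    ...   | v , cv , safe , phase′ = move (extendable⇒unblocked E) v cv λ a admissible →
              win (update c v a) (smaller (update-shrinks c v a cv)) (safe a admissible) (phase′ a)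

    ann-wins : Colorable G k → IndicatedColorable G k
    ann-wins (f , f-proper) =
      win _ (<-wellFounded _) (f , f-proper , λ _ _ ()) (inj₁ λ _ coloured → ⊥-elim (coloured refl))

colorable-mono : ∀ {n} {G : Graph n} {χ k} → χ ≤ k → Colorable G χ → Colorable G k
colorable-mono χ≤k (f , f-proper) =
  (λ v → inject≤ (f v) χ≤k) ,
  (λ u v uv eq → f-proper u v uv (inject≤-injective χ≤k χ≤k (f u) (f v) eq))

-- In K[F̄](m), vertices over the same side of a bipartition of F are adjacent:
-- in the same blow-up clique they are distinct, otherwise their F-vertices
-- are distinct and non-adjacent in F.
expansion-two-cliques : ∀ {p} (F : Graph p) (side : Fin p → Bool) →
  (∀ u v → adj F u v ≡ true → side u ≢ side v) → (m : Fin p → ℕ) →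
  ∀ i a j b → side i ≡ side j → (i , a) ≢ (j , b) → expAdj (complementAdj F) m (i , a) (j , b) ≡ true
expansion-two-cliques F side bipartite m i a j b si≡sj ne with i ≟ j
... | yes refl with a ≟ b
...   | yes refl = ⊥-elim (ne refl)
...   | no _     = refl
expansion-two-cliques F side bipartite m i a j b si≡sj ne | no i≢j
  rewrite dec-false (i ≟ j) i≢j with adj F i j in ij
... | true  = ⊥-elim (bipartite i j ij si≡sj)
... | false = refl

expansion-covered : ∀ {n p} (G : Graph n) (F : Graph p) → Bipartite F → (m : Fin p → ℕ) →
  IsomorphicTo G (expAdj (complementAdj F) m) → ∃ (CoveredByTwoCliques G)
expansion-covered G F (side , bipartite) m (φ , iso) =
  (λ u → side (proj₁ (Inverse.to φ u))) , λ u w su≡sw u≢w →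
    trans (iso u w) (expansion-two-cliques F side bipartite m _ _ _ _ su≡sw
                       (λ eq → u≢w (Injection.injective (↔⇒↣ φ) eq)))

corollary3p7 : ∀ {n p} (G : Graph n) (F : Graph p) → Bipartite F
    → (m : Fin p → ℕ) → (∀ i → 0 < m i)
    → IsomorphicTo G (expAdj (complementAdj F) m)
    → ∀ χ → IsChromaticNumber G χ
    → ∀ k → χ ≤ k → IndicatedColorable G k
corollary3p7 G F bipartite m _ iso χ (χ-colorable , _) k χ≤k =
  let side , cover = expansion-covered G F bipartite m iso
  in  IndicatedGame.TwoCliqueStrategy.ann-wins G side cover (colorable-mono {G = G} χ≤k χ-colorable)
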